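{- Let $\alpha\geq 0$ and let $G$ be an $\alpha$-greedy orientable graph, and let $k\geq\alpha+\chi(G)$ be an integer. Then for every subgraph $H$ of $\overline{G}$, $$m(G,H,k)\leq\frac{|E(H)|}{k-\chi(G)+1-\alpha}.$$
   Context: All graphs are finite, simple and unweighted; $\overline{G}$ is the complement of $G$ and $\chi(G)$ its chromatic number. A $k$-coloring of $G$ is a map $\phi:V(G)\to\{1,\dots,k\}$ with $\phi(u)\neq\phi(v)$ for every edge $uv$ of $G$; for a subgraph $H$ of $\overline{G}$ an edge $uv$ of $H$ is monochromatic if $\phi(u)=\phi(v)$, and for $k\geq\chi(G)$, $m(G,H,k)$ is the minimum over all $k$-colorings of $G$ of the number of monochromatic edges of $H$. Given an ordering of $V(G)$, orient each edge $uv$ from $u$ to $v$ when $u$ precedes $v$; let $\Delta^{ - }(\overrightarrow{G})$ be the maximum in-degree of the resulting oriented graph (i.e. the maximum over $v$ of the number of neighbours of $v$ preceding $v$). $G$ is $\alpha$-greedy orientable ($\alpha\ge 0$) if there is an ordering of $V(G)$ with $\Delta^{ - }(\overrightarrow{G})=\chi(G)-1+\alpha$. -}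

module Defs where

open import Data.Nat using (ℕ; zero; suc; _+_; _*_; _∸_; _≤_; _<_; _⊔_; _<ᵇ_)
open import Data.Bool using (Bool; true; false; _∧_; if_then_else_)
open import Data.Fin using (Fin; toℕ; _≟_)
open import Data.List using (List; map; foldr; allFin)
open import Data.Nat.ListAction using (sum)
open import Relation.Nullary using (¬_)
open import Data.Product using (Σ; _×_; _,_)
open import Relation.Binary.PropositionalEquality using (_≡_)
open import Relation.Nullary.Decidable using (⌊_⌋)
open import Function.Definitions using (Injective)

record Graph (n : ℕ) : Set where
  field
    adj    : Fin n → Fin n → Bool
    sym    : ∀ i j → adj i j ≡ adj j i
    irrefl : ∀ i → adj i i ≡ false
open Graph public

[_] : Bool → ℕ
[ b ] = if b then 1 else 0

count : {n : ℕ} → (Fin n → Bool) → ℕ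
count {n} p = sum (map (λ i → [ p i ]) (allFin n))

maxFin : {n : ℕ} → (Fin n → ℕ) → ℕ
maxFin {n} f = foldr _⊔_ 0 (map f (allFin n))

-- |E(G)|: unordered pairs {i,j}, counted once as i < j
numEdges : {n : ℕ} → Graph n → ℕ
numEdges {n} G = sum (map (λ i → count (λ j → adj G i j ∧ (toℕ i <ᵇ toℕ j))) (allFin n))

SubgraphOfComplement : {n : ℕ} → Graph n → Graph n → Set
SubgraphOfComplement G H = ∀ i j → adj H i j ≡ true → adj G i j ≡ false

IsColoring : {n : ℕ} → Graph n → (k : ℕ) → (Fin n → Fin k) → Set
IsColoring G k φ = ∀ u v → adj G u v ≡ true → ¬ (φ u ≡ φ v)

Colorable : {n : ℕ} → Graph n → ℕ → Set
Colorable {n} G k = Σ (Fin n → Fin k) (IsColoring G k)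

IsChromaticNumber : {n : ℕ} → Graph n → ℕ → Set
IsChromaticNumber G c = Colorable G c × (∀ k → Colorable G k → c ≤ k)

monoEdges : {n k : ℕ} → Graph n → (Fin n → Fin k) → ℕ
monoEdges {n} H φ =
  sum (map (λ i → count (λ j → adj H i j ∧ (toℕ i <ᵇ toℕ j) ∧ ⌊ φ i ≟ φ j ⌋)) (allFin n))

IsMinMono : {n : ℕ} → Graph n → Graph n → ℕ → ℕ → Set
IsMinMono G H k m =
  Σ (Fin _ → Fin k) (λ φ → IsColoring G k φ × monoEdges H φ ≡ m)
  × (∀ φ → IsColoring G k φ → m ≤ monoEdges H φ)

-- maximum in-degree Δ⁻ of the orientation induced by the ordering pos
-- (pos v = position of v; u precedes v iff pos u < pos v)
maxInDegree : {n : ℕ} → Graph n → (Fin n → Fin n) → ℕ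
maxInDegree G pos =
  maxFin (λ v → count (λ u → adj G u v ∧ (toℕ (pos u) <ᵇ toℕ (pos v))))

-- G is α-greedy orientable, given χ(G) = c:
-- some ordering has Δ⁻ = χ(G) - 1 + α  (written Δ⁻ + 1 = χ(G) + α)
GreedyOrientable : {n : ℕ} → Graph n → (c α : ℕ) → Set
GreedyOrientable {n} G c α =
  Σ (Fin n → Fin n) (λ pos → Injective _≡_ _≡_ pos × (maxInDegree G pos + 1 ≡ c + α))

-- Colour the vertices greedily in the given order.  The vertex v has at most
-- d = Δ⁻ earlier G-neighbours, so at least t = k − d colours are still free
-- for it, and by averaging one of them is used by at most a 1/t fraction of
-- the N_v earlier H-neighbours of v.  Choosing that colour charges v with at
-- most N_v / t monochromatic H-edges to earlier vertices; summing over v,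
-- and using Σ_v N_v = |E(H)|, gives t · m(G,H,k) ≤ |E(H)|, and
-- t = k + 1 − (χ(G) + α) by α-greedy orientability.
module Submission where

open import Defs renaming (sym to adj-sym)
open import Data.Bool using (Bool; true; false; _∧_; not; if_then_else_)
open import Data.Bool.Properties using (∧-zeroʳ; T-≡; ∧-commutativeMonoid)
open import Algebra.Bundles using (module CommutativeMonoid)
open import Algebra.Properties.CommutativeSemigroup (CommutativeMonoid.commutativeSemigroup ∧-commutativeMonoid)
  using (x∙yz≈xz∙y; xy∙z≈xz∙y)
open import Data.Fin using (Fin; zero; suc; toℕ; fromℕ<; punchIn; _≟_)
open import Data.Fin.Properties using (toℕ-injective; toℕ<n; any?; punchInᵢ≢i)
open import Data.List using (map; foldr; tabulate; allFin)
import Data.List.Properties as List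
import Data.Nat.ListAction as List
open import Data.Nat using (ℕ; zero; suc; _+_; _*_; _∸_; _≤_; _<_; _⊔_; _≡ᵇ_; _<ᵇ_; z≤n; s≤s; s≤s⁻¹)
open import Data.Nat.Properties hiding (_≟_)
import Data.Nat.Properties as ℕ using (_≟_)
open import Algebra.Properties.Semiring.Sum +-*-semiring
  using (sum-syntax; sum-cong-≗; ∑-comm; ∑-distrib-+; *-distribˡ-sum; sum-remove; sum-replicate-zero)
open import Data.Product using (_×_; _,_; proj₁; proj₂; ∃-syntax)
open import Function using (id; _∘_)
open import Function.Bundles using (module Equivalence)
open import Function.Definitions using (Injective)
open import Relation.Binary using (tri<; tri≈; tri>)
open import Relation.Binary.PropositionalEquality
  using (_≡_; _≢_; refl; sym; trans; cong; cong₂; subst; subst₂; module ≡-Reasoning)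
open import Relation.Nullary using (¬_; yes; no; contradiction)
open import Relation.Nullary.Decidable using (⌊_⌋; _×-dec_)

private
  variable
    n k : ℕ

sum-tabulate : (f : Fin n → ℕ) → List.sum (tabulate f) ≡ ∑[ i < n ] f i
sum-tabulate {zero}  f = refl
sum-tabulate {suc n} f = cong (f zero +_) (sum-tabulate (f ∘ suc))

sum-map-allFin : (f : Fin n → ℕ) → List.sum (map f (allFin n)) ≡ ∑[ i < n ] f i
sum-map-allFin f = trans (cong List.sum (List.map-tabulate id f)) (sum-tabulate f)

count≡∑ : (p : Fin n → Bool) → count p ≡ ∑[ i < n ] [ p i ]
count≡∑ p = sum-map-allFin (λ i → [ p i ])

count-cong : {p q : Fin n → Bool} → (∀ i → p i ≡ q i) → count p ≡ count q
count-cong p≗q = cong List.sum (List.map-cong (cong [_] ∘ p≗q) (allFin _))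

∑-mono-≤ : {f g : Fin n → ℕ} → (∀ i → f i ≤ g i) → ∑[ i < n ] f i ≤ ∑[ i < n ] g i
∑-mono-≤ {zero}  f≤g = z≤n
∑-mono-≤ {suc n} f≤g = +-mono-≤ (f≤g zero) (∑-mono-≤ (f≤g ∘ suc))

∑-one : ∀ n → ∑[ i < n ] 1 ≡ n
∑-one zero    = refl
∑-one (suc n) = cong suc (∑-one n)

≤-∑ : (f : Fin n → ℕ) (i : Fin n) → f i ≤ ∑[ j < n ] f j
≤-∑ f zero    = m≤m+n _ _
≤-∑ f (suc i) = ≤-trans (≤-∑ (f ∘ suc) i) (m≤n+m _ _)

⌊≟⌋-≢ : {x y : Fin n} → x ≢ y → ⌊ x ≟ y ⌋ ≡ false
⌊≟⌋-≢ {x = x} {y} x≢y with x ≟ y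
... | yes x≡y = contradiction x≡y x≢y
... | no _    = refl

⌊≟⌋-refl : (x : Fin n) → ⌊ x ≟ x ⌋ ≡ true
⌊≟⌋-refl x with x ≟ x
... | yes _   = refl
... | no x≢x  = contradiction refl x≢x

⌊≟⌋≡false⇒≢ : {x y : Fin n} → ⌊ x ≟ y ⌋ ≡ false → x ≢ y
⌊≟⌋≡false⇒≢ x≟y≡false refl = contradiction (trans (sym (⌊≟⌋-refl _)) x≟y≡false) λ ()

∑-indicator-≟ : (x : Fin n) → ∑[ c < n ] [ ⌊ x ≟ c ⌋ ] ≡ 1
∑-indicator-≟ {suc n} x = begin
  ∑[ c < suc n ] [ ⌊ x ≟ c ⌋ ]                     ≡⟨ sum-remove {i = x} (λ c → [ ⌊ x ≟ c ⌋ ]) ⟩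
  [ ⌊ x ≟ x ⌋ ] + ∑[ c < n ] [ ⌊ x ≟ punchIn x c ⌋ ] ≡⟨ cong₂ _+_ (cong [_] (⌊≟⌋-refl x)) others ⟩
  1 + ∑[ c < n ] 0                                  ≡⟨ cong suc (sum-replicate-zero n) ⟩
  1                                                 ∎
  where
  open ≡-Reasoning
  others : ∑[ c < n ] [ ⌊ x ≟ punchIn x c ⌋ ] ≡ ∑[ c < n ] 0
  others = sum-cong-≗ (λ c → cong [_] (⌊≟⌋-≢ (punchInᵢ≢i x c ∘ sym)))

∑-count-fibres : (p : Fin n → Bool) (ψ : Fin n → Fin k) →
                 ∑[ c < k ] count (λ u → p u ∧ ⌊ ψ u ≟ c ⌋) ≡ count p
∑-count-fibres {n} {k} p ψ = begin
  ∑[ c < k ] count (λ u → p u ∧ ⌊ ψ u ≟ c ⌋)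
    ≡⟨ sum-cong-≗ (λ c → count≡∑ (λ u → p u ∧ ⌊ ψ u ≟ c ⌋)) ⟩
  ∑[ c < k ] ∑[ u < n ] [ p u ∧ ⌊ ψ u ≟ c ⌋ ]
    ≡⟨ ∑-comm (λ c u → [ p u ∧ ⌊ ψ u ≟ c ⌋ ]) ⟩
  ∑[ u < n ] ∑[ c < k ] [ p u ∧ ⌊ ψ u ≟ c ⌋ ]
    ≡⟨ sum-cong-≗ fibre ⟩
  ∑[ u < n ] [ p u ]
    ≡⟨ count≡∑ p ⟨
  count p ∎
  where
  open ≡-Reasoning
  fibre : ∀ u → ∑[ c < k ] [ p u ∧ ⌊ ψ u ≟ c ⌋ ] ≡ [ p u ]
  fibre u with p u
  ... | true  = ∑-indicator-≟ (ψ u)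
  ... | false = sum-replicate-zero k

≤-count : (p : Fin n → Bool) (i : Fin n) → [ p i ] ≤ count p
≤-count p i = subst ([ p i ] ≤_) (sym (count≡∑ p)) (≤-∑ (λ j → [ p j ]) i)

count≡0⇒false : (p : Fin n → Bool) → count p ≡ 0 → ∀ i → p i ≡ false
count≡0⇒false p count≡0 i with p i in pᵢ
... | false = refl
... | true  = contradiction (subst₂ _≤_ (cong [_] pᵢ) count≡0 (≤-count p i)) λ ()

maxFin-upper : (f : Fin n → ℕ) (i : Fin n) → f i ≤ maxFin f
maxFin-upper f i = subst (f i ≤_) (cong (foldr _⊔_ 0) (sym (List.map-tabulate id f))) (upper f i)
  where
  upper : ∀ {n} (f : Fin n → ℕ) i → f i ≤ foldr _⊔_ 0 (tabulate f)
  upper f zero    = m≤m⊔n _ _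
  upper f (suc i) = ≤-trans (upper (f ∘ suc) i) (m≤n⊔m _ _)

-- Choosing a colour

[not≡ᵇ0]≤ : ∀ x → [ not (x ≡ᵇ 0) ] ≤ x
[not≡ᵇ0]≤ zero    = z≤n
[not≡ᵇ0]≤ (suc x) = s≤s z≤n

[b]+[not-b] : ∀ b → [ b ] + [ not b ] ≡ 1
[b]+[not-b] true  = refl
[b]+[not-b] false = refl

-- Applied with g c and h c the numbers of earlier G- and H-neighbours of
-- colour c, so that the free colours are those with g c ≡ 0.
free-colours-not-all-heavy : ∀ {d N} (g h : Fin k → ℕ) → d < k →
                             ∑[ c < k ] g c ≤ d → ∑[ c < k ] h c ≤ N →
                             ¬ (∀ c → g c ≡ 0 → N < (k ∸ d) * h c)
free-colours-not-all-heavy {k} {d} {N} g h d<k ∑g≤d ∑h≤N heavy =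
  <⇒≱ (m<n+m (N * t) (m<n⇒0<n∸m d<k)) (begin
    suc N * t                  ≤⟨ *-monoʳ-≤ (suc N) t≤#free ⟩
    suc N * #free              ≤⟨ #free-weighted ⟩
    t * N                      ≡⟨ *-comm t N ⟩
    N * t                      ∎)
  where
  open ≤-Reasoning
  t = k ∸ d
  free : Fin k → Bool
  free c = g c ≡ᵇ 0
  #free #used : ℕ
  #free = ∑[ c < k ] [ free c ]
  #used = ∑[ c < k ] [ not (free c) ]

  #used≤d : #used ≤ d
  #used≤d = ≤-trans (∑-mono-≤ (λ c → [not≡ᵇ0]≤ (g c))) ∑g≤d

  #free+#used : #free + #used ≡ k
  #free+#used = trans (sym (∑-distrib-+ (λ c → [ free c ]) (λ c → [ not (free c) ])))
                      (trans (sum-cong-≗ (λ c → [b]+[not-b] (free c))) (∑-one k))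

  t≤#free : t ≤ #free
  t≤#free = m≤n+o⇒m∸n≤o k d (begin
    k             ≡⟨ #free+#used ⟨
    #free + #used ≤⟨ +-monoʳ-≤ #free #used≤d ⟩
    #free + d     ≡⟨ +-comm #free d ⟩
    d + #free     ∎)

  heavy-if-free : ∀ c → suc N * [ free c ] ≤ t * h c
  heavy-if-free c with g c in g≡
  ... | zero  = ≤-trans (≤-reflexive (*-identityʳ (suc N))) (heavy c g≡)
  ... | suc _ = ≤-trans (≤-reflexive (*-zeroʳ (suc N))) z≤n

  #free-weighted : suc N * #free ≤ t * N
  #free-weighted = begin
    suc N * #free                       ≡⟨ *-distribˡ-sum (suc N) (λ c → [ free c ]) ⟩
    ∑[ c < k ] (suc N * [ free c ])     ≤⟨ ∑-mono-≤ heavy-if-free ⟩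
    ∑[ c < k ] (t * h c)                ≡⟨ *-distribˡ-sum t h ⟨
    t * ∑[ c < k ] h c                  ≤⟨ *-monoʳ-≤ t ∑h≤N ⟩
    t * N                               ∎

free-light-colour : ∀ {d N} (g h : Fin k → ℕ) → d < k →
                    ∑[ c < k ] g c ≤ d → ∑[ c < k ] h c ≤ N →
                    ∃[ c ] g c ≡ 0 × (k ∸ d) * h c ≤ N
free-light-colour {k} {d} {N} g h d<k ∑g≤d ∑h≤N
  with any? (λ c → g c ℕ.≟ 0 ×-dec (k ∸ d) * h c ≤? N)
... | yes light = light
... | no ¬light = contradiction (λ c g≡0 → ≰⇒> (λ light → ¬light (c , g≡0 , light)))
                                (free-colours-not-all-heavy g h d<k ∑g≤d ∑h≤N)

-- Counting edges along an ordering

precedes : (Fin n → Fin n) → Fin n → Fin n → Bool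
precedes pos u v = toℕ (pos u) <ᵇ toℕ (pos v)

<ᵇ≡true⇒< : ∀ {a b} → (a <ᵇ b) ≡ true → a < b
<ᵇ≡true⇒< a<b = <ᵇ⇒< _ _ (Equivalence.from T-≡ a<b)

<⇒<ᵇ≡true : ∀ {a b} → a < b → (a <ᵇ b) ≡ true
<⇒<ᵇ≡true a<b = Equivalence.to T-≡ (<⇒<ᵇ a<b)

inDegree : Graph n → (Fin n → Fin n) → Fin n → ℕ
inDegree G pos v = count (λ u → adj G u v ∧ precedes pos u v)

inDegree≤maxInDegree : (G : Graph n) (pos : Fin n → Fin n) (v : Fin n) →
                       inDegree G pos v ≤ maxInDegree G pos
inDegree≤maxInDegree G pos = maxFin-upper (inDegree G pos)

Tournament : (Fin n → Fin n → Bool) → Set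
Tournament L = ∀ i j → i ≢ j → [ L i j ] + [ L j i ] ≡ 1

<ᵇ-tournament : ∀ a b → a ≢ b → [ a <ᵇ b ] + [ b <ᵇ a ] ≡ 1
<ᵇ-tournament zero    zero    a≢b = contradiction refl a≢b
<ᵇ-tournament zero    (suc b) a≢b = refl
<ᵇ-tournament (suc a) zero    a≢b = refl
<ᵇ-tournament (suc a) (suc b) a≢b = <ᵇ-tournament a b (a≢b ∘ cong suc)

precedes-tournament : {pos : Fin n → Fin n} → Injective _≡_ _≡_ pos → Tournament (precedes pos)
precedes-tournament {pos = pos} pos-injective i j i≢j =
  <ᵇ-tournament (toℕ (pos i)) (toℕ (pos j)) (i≢j ∘ pos-injective ∘ toℕ-injective)

arcs : Graph n → (Fin n → Fin n → Bool) → ℕ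
arcs {n} G L = ∑[ i < n ] ∑[ j < n ] [ adj G i j ∧ L i j ]

-- Each edge {i, j} is counted once by L and once by its reverse.
arcs-double : (G : Graph n) {L : Fin n → Fin n → Bool} → Tournament L →
              2 * arcs G L ≡ ∑[ i < n ] ∑[ j < n ] [ adj G i j ]
arcs-double {n} G {L} L-tournament = begin
  2 * arcs G L
    ≡⟨ cong (arcs G L +_) (+-identityʳ (arcs G L)) ⟩
  arcs G L + arcs G L
    ≡⟨ cong (arcs G L +_) (∑-comm (λ i j → [ adj G i j ∧ L i j ])) ⟩
  arcs G L + ∑[ i < n ] ∑[ j < n ] [ adj G j i ∧ L j i ]
    ≡⟨ cong (arcs G L +_) (sum-cong-≗ λ i → sum-cong-≗ λ j →
         cong (λ a → [ a ∧ L j i ]) (adj-sym G j i)) ⟩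
  arcs G L + ∑[ i < n ] ∑[ j < n ] [ adj G i j ∧ L j i ]
    ≡⟨ ∑-distrib-+ (λ i → ∑[ j < n ] [ adj G i j ∧ L i j ]) (λ i → ∑[ j < n ] [ adj G i j ∧ L j i ]) ⟨
  ∑[ i < n ] (∑[ j < n ] [ adj G i j ∧ L i j ] + ∑[ j < n ] [ adj G i j ∧ L j i ])
    ≡⟨ sum-cong-≗ (λ i → ∑-distrib-+ (λ j → [ adj G i j ∧ L i j ]) (λ j → [ adj G i j ∧ L j i ])) ⟨
  ∑[ i < n ] ∑[ j < n ] ([ adj G i j ∧ L i j ] + [ adj G i j ∧ L j i ])
    ≡⟨ sum-cong-≗ (λ i → sum-cong-≗ (both-directions i)) ⟩
  ∑[ i < n ] ∑[ j < n ] [ adj G i j ] ∎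
  where
  open ≡-Reasoning
  both-directions : ∀ i j → [ adj G i j ∧ L i j ] + [ adj G i j ∧ L j i ] ≡ [ adj G i j ]
  both-directions i j with adj G i j in ij
  ... | false = refl
  ... | true  = L-tournament i j λ { refl → contradiction (trans (sym ij) (irrefl G i)) λ () }

arcs-tournament-invariant : (G : Graph n) {L L′ : Fin n → Fin n → Bool} →
                            Tournament L → Tournament L′ → arcs G L ≡ arcs G L′
arcs-tournament-invariant G {L} {L′} L-tournament L′-tournament =
  *-cancelˡ-≡ (arcs G L) (arcs G L′) 2
    (trans (arcs-double G L-tournament) (sym (arcs-double G L′-tournament)))

numEdges≡∑inDegree : (G : Graph n) {pos : Fin n → Fin n} → Injective _≡_ _≡_ pos →
                     numEdges G ≡ ∑[ v < n ] inDegree G pos v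
numEdges≡∑inDegree {n} G {pos} pos-injective = begin
  numEdges G
    ≡⟨ sum-map-allFin (λ i → count (λ j → adj G i j ∧ precedes id i j)) ⟩
  ∑[ i < n ] count (λ j → adj G i j ∧ precedes id i j)
    ≡⟨ sum-cong-≗ (λ i → count≡∑ (λ j → adj G i j ∧ precedes id i j)) ⟩
  arcs G (precedes id)
    ≡⟨ arcs-tournament-invariant G (precedes-tournament id) (precedes-tournament pos-injective) ⟩
  arcs G (precedes pos)
    ≡⟨ ∑-comm (λ u v → [ adj G u v ∧ precedes pos u v ]) ⟩
  ∑[ v < n ] ∑[ u < n ] [ adj G u v ∧ precedes pos u v ]
    ≡⟨ sum-cong-≗ (λ v → count≡∑ (λ u → adj G u v ∧ precedes pos u v)) ⟨
  ∑[ v < n ] inDegree G pos v ∎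
  where open ≡-Reasoning

-- Monochromatic edges

⌊≟⌋-sym : (x y : Fin k) → ⌊ x ≟ y ⌋ ≡ ⌊ y ≟ x ⌋
⌊≟⌋-sym x y with x ≟ y
... | yes refl = sym (⌊≟⌋-refl x)
... | no x≢y   = sym (⌊≟⌋-≢ (x≢y ∘ sym))

monochromatic : Graph n → (Fin n → Fin k) → Graph n
monochromatic H φ = record
  { adj    = λ i j → adj H i j ∧ ⌊ φ i ≟ φ j ⌋
  ; sym    = λ i j → cong₂ _∧_ (adj-sym H i j) (⌊≟⌋-sym (φ i) (φ j))
  ; irrefl = λ i → cong (_∧ ⌊ φ i ≟ φ i ⌋) (irrefl H i)
  }

monoEdges≡numEdges-monochromatic : (H : Graph n) (φ : Fin n → Fin k) →
                                   monoEdges H φ ≡ numEdges (monochromatic H φ)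
monoEdges≡numEdges-monochromatic H φ =
  cong List.sum (List.map-cong (λ i → count-cong (λ j →
    x∙yz≈xz∙y (adj H i j) (toℕ i <ᵇ toℕ j) ⌊ φ i ≟ φ j ⌋)) (allFin _))

colourInDegree : Graph n → (Fin n → Fin n) → (Fin n → Fin k) → Fin n → Fin k → ℕ
colourInDegree G pos ψ v c = count (λ u → (adj G u v ∧ precedes pos u v) ∧ ⌊ ψ u ≟ c ⌋)

∑-colourInDegree : (G : Graph n) (pos : Fin n → Fin n) (ψ : Fin n → Fin k) (v : Fin n) →
                   ∑[ c < k ] colourInDegree G pos ψ v c ≡ inDegree G pos v
∑-colourInDegree G pos ψ v = ∑-count-fibres (λ u → adj G u v ∧ precedes pos u v) ψ

colourInDegree-local : (G : Graph n) (pos : Fin n → Fin n) {ψ ψ′ : Fin n → Fin k} {v : Fin n} →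
                       (∀ u → precedes pos u v ≡ true → ψ u ≡ ψ′ u) →
                       ∀ c → colourInDegree G pos ψ v c ≡ colourInDegree G pos ψ′ v c
colourInDegree-local G pos {ψ} {ψ′} {v} agree c = count-cong same-term
  where
  same-term : ∀ u → (adj G u v ∧ precedes pos u v) ∧ ⌊ ψ u ≟ c ⌋
                  ≡ (adj G u v ∧ precedes pos u v) ∧ ⌊ ψ′ u ≟ c ⌋
  same-term u with precedes pos u v in u<v
  ... | true  = cong (λ x → (adj G u v ∧ true) ∧ ⌊ x ≟ c ⌋) (agree u u<v)
  ... | false rewrite ∧-zeroʳ (adj G u v) = refl

inDegree-monochromatic : (H : Graph n) (pos : Fin n → Fin n) (φ : Fin n → Fin k) (v : Fin n) →
                         inDegree (monochromatic H φ) pos v ≡ colourInDegree H pos φ v (φ v)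
inDegree-monochromatic H pos φ v =
  count-cong (λ u → xy∙z≈xz∙y (adj H u v) ⌊ φ u ≟ φ v ⌋ (precedes pos u v))

-- Greedy colouring along an ordering

module Greedy (pos : Fin n → Fin n) (ψ₀ : Fin n → Fin k)
              (choose : (Fin n → Fin k) → Fin n → Fin k) where

  position : Fin n → ℕ
  position v = toℕ (pos v)

  -- stage s is ψ₀ recoloured, in order, at the vertices of position below s
  stage : ℕ → Fin n → Fin k
  stage zero      = ψ₀
  stage (suc s) v = if ⌊ position v ℕ.≟ s ⌋ then choose (stage s) v else stage s v

  colouring : Fin n → Fin k
  colouring = stage n

  stage-settled : ∀ s v → position v < s → stage s v ≡ choose (stage (position v)) v
  stage-settled (suc s) v v<1+s with position v ℕ.≟ s
  ... | yes refl = refl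
  ... | no v≢s   = stage-settled s v (≤∧≢⇒< (s≤s⁻¹ v<1+s) v≢s)

  colouring-chooses : ∀ v → colouring v ≡ choose (stage (position v)) v
  colouring-chooses v = stage-settled n v (toℕ<n (pos v))

  stage-agrees : ∀ {u v} → precedes pos u v ≡ true → stage (position v) u ≡ colouring u
  stage-agrees {u} {v} u<v =
    trans (stage-settled (position v) u (<ᵇ≡true⇒< u<v)) (sym (colouring-chooses u))

module GreedyColouring (G H : Graph n) {pos : Fin n → Fin n} (pos-injective : Injective _≡_ _≡_ pos)
                       (Δ⁻<k : maxInDegree G pos < k) where

  t : ℕ
  t = k ∸ maxInDegree G pos

  SafeLight : (Fin n → Fin k) → Fin n → Fin k → Set
  SafeLight ψ v c = colourInDegree G pos ψ v c ≡ 0 × t * colourInDegree H pos ψ v c ≤ inDegree H pos v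

  safe-light-colour : ∀ ψ v → ∃[ c ] SafeLight ψ v c
  safe-light-colour ψ v =
    free-light-colour (colourInDegree G pos ψ v) (colourInDegree H pos ψ v) Δ⁻<k
      (≤-trans (≤-reflexive (∑-colourInDegree G pos ψ v)) (inDegree≤maxInDegree G pos v))
      (≤-reflexive (∑-colourInDegree H pos ψ v))

  SafeLight-local : ∀ {ψ ψ′ v c} → (∀ u → precedes pos u v ≡ true → ψ u ≡ ψ′ u) →
                    SafeLight ψ v c → SafeLight ψ′ v c
  SafeLight-local {c = c} agree (free , light) =
    trans (sym (colourInDegree-local G pos agree c)) free ,
    subst (λ x → t * x ≤ _) (colourInDegree-local H pos agree c) light

  open Greedy pos (λ _ → fromℕ< Δ⁻<k) (λ ψ v → proj₁ (safe-light-colour ψ v)) public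

  colouring-safe-light : ∀ v → SafeLight colouring v (colouring v)
  colouring-safe-light v = subst (SafeLight colouring v) (sym (colouring-chooses v))
    (SafeLight-local (λ u → stage-agrees) (proj₂ (safe-light-colour (stage (position v)) v)))

  colouring-proper-forward : ∀ {u v} → adj G u v ≡ true → precedes pos u v ≡ true →
                             colouring u ≢ colouring v
  colouring-proper-forward {u} {v} uv u<v = ⌊≟⌋≡false⇒≢ (begin
    ⌊ colouring u ≟ colouring v ⌋
      ≡⟨ cong₂ (λ a b → (a ∧ b) ∧ ⌊ colouring u ≟ colouring v ⌋) uv u<v ⟨
    (adj G u v ∧ precedes pos u v) ∧ ⌊ colouring u ≟ colouring v ⌋
      ≡⟨ count≡0⇒false _ (proj₁ (colouring-safe-light v)) u ⟩
    false ∎)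
    where open ≡-Reasoning

  colouring-proper : IsColoring G k colouring
  colouring-proper u v uv with <-cmp (position u) (position v)
  ... | tri< u<v _ _ = colouring-proper-forward uv (<⇒<ᵇ≡true u<v)
  ... | tri> _ _ v<u = colouring-proper-forward (trans (adj-sym G v u) uv) (<⇒<ᵇ≡true v<u) ∘ sym
  ... | tri≈ _ u≈v _ with pos-injective (toℕ-injective u≈v)
  ...   | refl = contradiction (trans (sym uv) (irrefl G u)) λ ()

  t*monoEdges≤numEdges : t * monoEdges H colouring ≤ numEdges H
  t*monoEdges≤numEdges = begin
    t * monoEdges H colouring
      ≡⟨ cong (t *_) (monoEdges≡numEdges-monochromatic H colouring) ⟩
    t * numEdges (monochromatic H colouring)
      ≡⟨ cong (t *_) (numEdges≡∑inDegree (monochromatic H colouring) pos-injective) ⟩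
    t * ∑[ v < n ] inDegree (monochromatic H colouring) pos v
      ≡⟨ *-distribˡ-sum t (inDegree (monochromatic H colouring) pos) ⟩
    ∑[ v < n ] (t * inDegree (monochromatic H colouring) pos v)
      ≡⟨ sum-cong-≗ (λ v → cong (t *_) (inDegree-monochromatic H pos colouring v)) ⟩
    ∑[ v < n ] (t * colourInDegree H pos colouring v (colouring v))
      ≤⟨ ∑-mono-≤ (proj₂ ∘ colouring-safe-light) ⟩
    ∑[ v < n ] inDegree H pos v
      ≡⟨ numEdges≡∑inDegree H pos-injective ⟨
    numEdges H ∎
    where open ≤-Reasoning

theorem9 : ∀ {n : ℕ} (G H : Graph n) (χ α k m : ℕ) →
    IsChromaticNumber G χ →
    GreedyOrientable G χ α →
    χ + α ≤ k →
    SubgraphOfComplement G H →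
    IsMinMono G H k m →
    m * (k + 1 ∸ (χ + α)) ≤ numEdges H
theorem9 G H χ α k m _ (pos , pos-injective , Δ⁻+1≡χ+α) χ+α≤k _ (_ , minimal) = begin
  m * (k + 1 ∸ (χ + α))   ≡⟨ cong (λ x → m * (k + 1 ∸ x)) Δ⁻+1≡χ+α ⟨
  m * (k + 1 ∸ (Δ⁻ + 1))  ≡⟨ cong (m *_) (cong₂ _∸_ (+-comm k 1) (+-comm Δ⁻ 1)) ⟩
  m * t                   ≡⟨ *-comm m t ⟩
  t * m                   ≤⟨ *-monoʳ-≤ t (minimal colouring colouring-proper) ⟩
  t * monoEdges H colouring ≤⟨ t*monoEdges≤numEdges ⟩
  numEdges H              ∎
  where
  open ≤-Reasoning
  Δ⁻ = maxInDegree G pos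
  Δ⁻<k : Δ⁻ < k
  Δ⁻<k = subst (_≤ k) (trans (sym Δ⁻+1≡χ+α) (+-comm Δ⁻ 1)) χ+α≤k
  open GreedyColouring G H pos-injective Δ⁻<k
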